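{- For $B\geq 2$ and $|q|<1$, $$\sum_{n=1}^{\infty} \widehat{c}_B(n-1,1)q^n = (B-1)\sum_{i=1}^{\infty}\frac{q^{B^i}}{1-q^{B^i}}.$$
   Context: For integers $a,b\ge0$, $c_B(a,b)$ is the base-$B$ carry sum of $a+b$, i.e. the sum of all carried numbers produced when computing $a+b$ by the traditional base-$B$ column addition algorithm, and $\widehat{c}_B(a,b):=(B-1)c_B(a,b)$. -}

module Defs where

open import Data.Nat using (ℕ; zero; suc; _+_; _*_; _∸_; _^_; NonZero)
open import Data.Nat.DivMod using (_/_; _%_)
open import Data.Nat.Divisibility using (_∣?_)
open import Relation.Nullary.Decidable using (does)
open import Data.Bool using (if_then_else_)

carries : (B : ℕ) .{{_ : NonZero B}} → ℕ → ℕ → ℕ → ℕ → ℕ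
carries B a b c zero    = 0
carries B a b c (suc k) =
  let c′ = (a % B + b % B + c) / B
  in c′ + carries B (a / B) (b / B) c′ k

-- c_B(a,b): sum of all carries in a+b.  a+b+1 columns always suffice (for B ≥ 2
-- every later column has zero digits and zero carry, hence produces no carry).
carrySum : (B : ℕ) .{{_ : NonZero B}} → ℕ → ℕ → ℕ
carrySum B a b = carries B a b 0 (suc (a + b))

carrySumHat : (B : ℕ) .{{_ : NonZero B}} → ℕ → ℕ → ℕ
carrySumHat B a b = (B ∸ 1) * carrySum B a b

FPS : Set
FPS = ℕ → ℕ

lhsSeries : (B : ℕ) .{{_ : NonZero B}} → FPS
lhsSeries B zero    = 0
lhsSeries B (suc m) = carrySumHat B m 1

-- q^m/(1-q^m) = Σ_{k≥1} q^{k m}  (for m ≥ 1): coefficient of q^n is 1 iff n ≥ 1 and m ∣ n.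
lambertTerm : ℕ → FPS
lambertTerm m zero    = 0
lambertTerm m (suc n) = if does (m ∣? suc n) then 1 else 0

sumRange : ℕ → (ℕ → ℕ) → ℕ
sumRange zero    f = 0
sumRange (suc N) f = sumRange N f + f (suc N)

-- RHS: (B-1) Σ_{i≥1} q^{B^i}/(1-q^{B^i}).  The i-th summand has lowest-degree term
-- q^{B^i} with B^i > n whenever i > n (B ≥ 2), so the coefficient of q^n of the
-- (formally convergent) infinite sum is the finite sum over 1 ≤ i ≤ n.
rhsSeries : (B : ℕ) → FPS
rhsSeries B n = (B ∸ 1) * sumRange n (λ i → lambertTerm (B ^ i) n)

-- Adding 1 to a in base B carries out of the i-th column exactly when the i
-- lowest digits of a are all B − 1, that is when B ^ i ∣ a + 1; once a column
-- produces no carry, no later column does.  Hence c_B(a, 1) is the number of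
-- i ≥ 1 with B ^ i ∣ a + 1, which is the coefficient of q ^ (a + 1) in
-- Σ_{i ≥ 1} q ^ B ^ i / (1 − q ^ B ^ i).
module Submission where

open import Defs
open import Data.Nat
open import Data.Nat.Properties
open import Data.Nat.DivMod
open import Data.Nat.Divisibility
open import Function using (_⇔_; mk⇔; Equivalence)
open import Relation.Nullary using (¬_; yes; no; contradiction)
open import Relation.Binary.PropositionalEquality

n<m^n : ∀ {m} → 1 < m → ∀ n → n < m ^ n
n<m^n 1<m zero    = z<s
n<m^n {m} 1<m (suc n) = begin-strict
  suc n     ≤⟨ n<m^n 1<m n ⟩
  m ^ n     <⟨ m<m*n (m ^ n) m 1<m ⟩
  m ^ n * m ≡⟨ *-comm (m ^ n) m ⟩
  m ^ suc n ∎
  where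
  open ≤-Reasoning
  instance
    _ : NonZero m
    _ = >-nonZero (<-trans z<s 1<m)
    _ : NonZero (m ^ n)
    _ = m^n≢0 m n

sumRange-cong : ∀ k {f g : ℕ → ℕ} → (∀ i → f i ≡ g i) → sumRange k f ≡ sumRange k g
sumRange-cong zero    f≗g = refl
sumRange-cong (suc k) f≗g = cong₂ _+_ (sumRange-cong k f≗g) (f≗g (suc k))

sumRange-zero : ∀ k {f : ℕ → ℕ} → (∀ i → f (suc i) ≡ 0) → sumRange k f ≡ 0
sumRange-zero zero    f≡0 = refl
sumRange-zero (suc k) f≡0 = cong₂ _+_ (sumRange-zero k f≡0) (f≡0 k)

sumRange-suc : ∀ k (f : ℕ → ℕ) → sumRange (suc k) f ≡ f 1 + sumRange k (λ i → f (suc i))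
sumRange-suc zero    f = sym (+-identityʳ (f 1))
sumRange-suc (suc k) f = begin
  sumRange (suc k) f + f (suc (suc k))
    ≡⟨ cong (_+ f (suc (suc k))) (sumRange-suc k f) ⟩
  f 1 + sumRange k (λ i → f (suc i)) + f (suc (suc k))
    ≡⟨ +-assoc (f 1) _ _ ⟩
  f 1 + sumRange (suc k) (λ i → f (suc i)) ∎
  where open ≡-Reasoning

lambertTerm-∣ : ∀ {d n} → d ∣ suc n → lambertTerm d (suc n) ≡ 1
lambertTerm-∣ {d} {n} d∣1+n with d ∣? suc n
... | yes _   = refl
... | no d∤1+n = contradiction d∣1+n d∤1+n

lambertTerm-∤ : ∀ {d n} → ¬ d ∣ suc n → lambertTerm d (suc n) ≡ 0
lambertTerm-∤ {d} {n} d∤1+n with d ∣? suc n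
... | yes d∣1+n = contradiction d∣1+n d∤1+n
... | no _      = refl

lambertTerm-cong : ∀ {d e m n} → d ∣ suc m ⇔ e ∣ suc n →
                   lambertTerm d (suc m) ≡ lambertTerm e (suc n)
lambertTerm-cong {d} {e} {m} {n} d⇔e with d ∣? suc m | e ∣? suc n
... | yes _    | yes _    = refl
... | no _     | no _     = refl
... | yes d∣   | no e∤   = contradiction (Equivalence.to d⇔e d∣) e∤
... | no d∤    | yes e∣   = contradiction (Equivalence.from d⇔e e∣) d∤

module _ (B : ℕ) .{{_ : NonZero B}} where

  private
    0%B≡0 : 0 % B ≡ 0
    0%B≡0 = m<n⇒m%n≡m (>-nonZero⁻¹ B)

    0/B≡0 : 0 / B ≡ 0
    0/B≡0 = 0/n≡0 B

  column-sum : ∀ a → a % B + 0 % B + 1 ≡ suc (a % B)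
  column-sum a = begin
    a % B + 0 % B + 1 ≡⟨ cong (λ r → a % B + r + 1) 0%B≡0 ⟩
    a % B + 0 + 1     ≡⟨ cong (_+ 1) (+-identityʳ (a % B)) ⟩
    a % B + 1         ≡⟨ +-comm (a % B) 1 ⟩
    suc (a % B)       ∎
    where open ≡-Reasoning

  carries-no-carry : ∀ k a → carries B a 0 0 k ≡ 0
  carries-no-carry zero    a = refl
  carries-no-carry (suc k) a = begin
    c + carries B (a / B) (0 / B) c k ≡⟨ cong (λ c → c + carries B (a / B) (0 / B) c k) c≡0 ⟩
    carries B (a / B) (0 / B) 0 k     ≡⟨ cong (λ b → carries B (a / B) b 0 k) 0/B≡0 ⟩
    carries B (a / B) 0 0 k           ≡⟨ carries-no-carry k (a / B) ⟩
    0                                 ∎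
    where
    open ≡-Reasoning
    c : ℕ
    c = (a % B + 0 % B + 0) / B
    c≡0 : c ≡ 0
    c≡0 = begin
      (a % B + 0 % B + 0) / B ≡⟨ cong (λ r → (a % B + r + 0) / B) 0%B≡0 ⟩
      (a % B + 0 + 0) / B     ≡⟨ cong (_/ B) (trans (+-identityʳ _) (+-identityʳ _)) ⟩
      a % B / B               ≡⟨ m<n⇒m/n≡0 (m%n<n a B) ⟩
      0                       ∎

  1+[m%n]≡n⇒1+m≡n*[1+m/n] : ∀ a → suc (a % B) ≡ B → suc a ≡ B * suc (a / B)
  1+[m%n]≡n⇒1+m≡n*[1+m/n] a last-digit = begin
    suc a                   ≡⟨ cong suc (m≡m%n+[m/n]*n a B) ⟩
    suc (a % B) + a / B * B ≡⟨ cong (_+ a / B * B) last-digit ⟩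
    B + a / B * B           ≡⟨ *-comm (suc (a / B)) B ⟩
    B * suc (a / B)         ∎
    where open ≡-Reasoning

  n∣1+m⇒1+[m%n]≡n : ∀ a → B ∣ suc a → suc (a % B) ≡ B
  n∣1+m⇒1+[m%n]≡n a B∣1+a =
    trans (cong suc (%-pred-≡0 (n∣m⇒m%n≡0 (suc a) B B∣1+a))) (suc-pred B)

  n∤1+m⇒1+[m%n]<n : ∀ a → ¬ B ∣ suc a → suc (a % B) < B
  n∤1+m⇒1+[m%n]<n a B∤1+a = ≤∧≢⇒< (m%n<n a B) λ last-digit →
    B∤1+a (divides (suc (a / B))
      (trans (1+[m%n]≡n⇒1+m≡n*[1+m/n] a last-digit) (*-comm B (suc (a / B)))))

  carries-successor : ∀ k a →
    carries B a 0 1 k ≡ sumRange k (λ i → lambertTerm (B ^ i) (suc a))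
  carries-successor zero    a = refl
  carries-successor (suc k) a with B ∣? suc a
  ... | yes B∣1+a = begin
    carries B a 0 1 (suc k)
      ≡⟨ cong (λ c → c + carries B (a / B) (0 / B) c k) carry≡1 ⟩
    1 + carries B (a / B) (0 / B) 1 k
      ≡⟨ cong (λ b → 1 + carries B (a / B) b 1 k) 0/B≡0 ⟩
    1 + carries B (a / B) 0 1 k
      ≡⟨ cong (1 +_) (carries-successor k (a / B)) ⟩
    1 + sumRange k (λ i → lambertTerm (B ^ i) (suc (a / B)))
      ≡⟨ cong₂ _+_ (sym (lambertTerm-∣ (subst (_∣ suc a) (sym (*-identityʳ B)) B∣1+a)))
                   (sumRange-cong k λ i → lambertTerm-cong (shift i)) ⟩
    lambertTerm (B ^ 1) (suc a) + sumRange k (λ i → lambertTerm (B ^ suc i) (suc a))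
      ≡⟨ sym (sumRange-suc k (λ i → lambertTerm (B ^ i) (suc a))) ⟩
    sumRange (suc k) (λ i → lambertTerm (B ^ i) (suc a)) ∎
    where
    open ≡-Reasoning
    carry≡1 : (a % B + 0 % B + 1) / B ≡ 1
    carry≡1 = trans (cong (_/ B) (trans (column-sum a) (n∣1+m⇒1+[m%n]≡n a B∣1+a))) (n/n≡1 B)
    1+a≡B*[1+a/B] : suc a ≡ B * suc (a / B)
    1+a≡B*[1+a/B] = 1+[m%n]≡n⇒1+m≡n*[1+m/n] a (n∣1+m⇒1+[m%n]≡n a B∣1+a)
    shift : ∀ i → B ^ i ∣ suc (a / B) ⇔ B ^ suc i ∣ suc a
    shift i = mk⇔
      (λ d → subst (B ^ suc i ∣_) (sym 1+a≡B*[1+a/B]) (*-monoʳ-∣ B d))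
      (λ d → *-cancelˡ-∣ B (subst (B ^ suc i ∣_) 1+a≡B*[1+a/B] d))
  ... | no B∤1+a = begin
    carries B a 0 1 (suc k)
      ≡⟨ cong (λ c → c + carries B (a / B) (0 / B) c k) carry≡0 ⟩
    carries B (a / B) (0 / B) 0 k
      ≡⟨ cong (λ b → carries B (a / B) b 0 k) 0/B≡0 ⟩
    carries B (a / B) 0 0 k
      ≡⟨ carries-no-carry k (a / B) ⟩
    0
      ≡⟨ sym (sumRange-zero (suc k) λ i →
               lambertTerm-∤ λ B^[1+i]∣1+a → B∤1+a (∣-trans (m∣m*n (B ^ i)) B^[1+i]∣1+a)) ⟩
    sumRange (suc k) (λ i → lambertTerm (B ^ i) (suc a)) ∎
    where
    open ≡-Reasoning
    carry≡0 : (a % B + 0 % B + 1) / B ≡ 0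
    carry≡0 = trans (cong (_/ B) (column-sum a)) (m<n⇒m/n≡0 (n∤1+m⇒1+[m%n]<n a B∤1+a))

  carries-1-0≡carries-0-1 : 1 < B → ∀ k a → carries B a 1 0 (suc k) ≡ carries B a 0 1 (suc k)
  carries-1-0≡carries-0-1 1<B k a
    rewrite m<n⇒m%n≡m 1<B | m<n⇒m/n≡0 1<B | 0%B≡0 | 0/B≡0
          | +-identityʳ (a % B + 1) | +-identityʳ (a % B) = refl

  carrySum-successor : 1 < B → ∀ a →
    carrySum B a 1 ≡ sumRange (suc a) (λ i → lambertTerm (B ^ i) (suc a))
  carrySum-successor 1<B a = begin
    carries B a 1 0 (suc (a + 1))         ≡⟨ carries-1-0≡carries-0-1 1<B (a + 1) a ⟩
    carries B a 0 1 (suc (a + 1))         ≡⟨ carries-successor (suc (a + 1)) a ⟩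
    sumRange (suc (a + 1)) f              ≡⟨ cong (λ k → sumRange (suc k) f) (+-comm a 1) ⟩
    sumRange (suc a) f + f (suc (suc a))  ≡⟨ cong (sumRange (suc a) f +_) top≡0 ⟩
    sumRange (suc a) f + 0                ≡⟨ +-identityʳ _ ⟩
    sumRange (suc a) f                    ∎
    where
    open ≡-Reasoning
    f : ℕ → ℕ
    f i = lambertTerm (B ^ i) (suc a)
    top≡0 : f (suc (suc a)) ≡ 0
    top≡0 = lambertTerm-∤ (>⇒∤ (<-trans (n<1+n (suc a)) (n<m^n 1<B (suc (suc a)))))

corollary2p6 : (B : ℕ) .{{_ : NonZero B}} → 2 ≤ B →
    (n : ℕ) → lhsSeries B n ≡ rhsSeries B n
corollary2p6 B 2≤B zero    = sym (*-zeroʳ (B ∸ 1))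
corollary2p6 B 2≤B (suc a) = cong ((B ∸ 1) *_) (carrySum-successor B 2≤B a)
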